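{- Let $\mathcal{G} = (G_1, \dots, G_T)$ be a temporal graph on vertex set $V = \{v_1, \dots, v_n\}$ and let $\Psi = \psi_1, \dots, \psi_T$ be a temporal sequence $2$-colouring of $\mathcal{G}$. Then there exists a partition of the vertex set of the auxiliary graph $\alpha(\mathcal{G})$ into two classes such that the number of edges of $\alpha(\mathcal{G})$ with both endpoints in the same class is exactly $\mathrm{Cost}(\Psi)$.
   Context: A temporal graph $(G_1, \dots, G_T)$ is a sequence of static graphs $G_t = (V, E_t)$ on a common vertex set. A temporal sequence $2$-colouring is a sequence $\psi_1, \dots, \psi_T$ where $\psi_t : V \to \{0,1\}$ is a proper colouring of $G_t$; its cost $\mathrm{Cost}(\Psi)$ is the number of pairs $(v, t)$, $1 \le t \le T-1$, with $\psi_t(v) \neq \psi_{t+1}(v)$. For a temporal graph all of whose snapshots are bipartite, the auxiliary static graph $\alpha(\mathcal{G})$ has vertex set $\{v_{i,t} : i \in \{1,\dots,n\}, t \in \{1,\dots,T\}\}$ and edge set $C \cup S$, where $C = \{v_{i,t} v_{i,t+1} : i \in \{1,\dots,n\}, t \in \{1,\dots,T-1\}\}$ and $S$ is obtained as follows: for each $t$ and each connected component $K$ of $G_t$, take a proper $2$-colouring $\psi$ of $K$, and add the edge $v_{i,t} v_{j,t}$ for every pair of vertices $v_i, v_j$ of $K$ with $\psi(v_i) \neq \psi(v_j)$. -}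

module Defs where

open import Level using (0ℓ)
open import Data.Nat using (ℕ; zero; suc; _+_; _<_)
open import Data.Fin using (Fin; toℕ; inject₁) renaming (suc to fsuc)
open import Data.Bool using (Bool; true; false)
open import Data.List using (List; length; map; allFin)
open import Data.Nat.ListAction using (sum)
open import Data.List.Relation.Unary.Unique.Propositional using (Unique)
open import Data.List.Membership.Propositional using (_∈_)
open import Data.Product using (Σ; ∃; _×_; _,_; proj₁; proj₂)
open import Data.Sum using (_⊎_)
open import Data.Empty using (⊥)
open import Function.Bundles using (_⇔_)
open import Relation.Binary.PropositionalEquality using (_≡_; _≢_)

record Graph (n : ℕ) : Set₁ where
  field
    Adj    : Fin n → Fin n → Set
    sym    : ∀ {i j} → Adj i j → Adj j i
    irrefl : ∀ {i} → Adj i i → ⊥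
open Graph public

Proper : ∀ {n} → Graph n → (Fin n → Bool) → Set
Proper G ψ = ∀ {i j} → Adj G i j → ψ i ≢ ψ j

-- i and j lie in the same connected component (there is a walk from i to j)
data Reach {n} (G : Graph n) : Fin n → Fin n → Set where
  here : ∀ {i} → Reach G i i
  step : ∀ {i j k} → Adj G i j → Reach G j k → Reach G i k

TemporalGraph : ℕ → ℕ → Set₁
TemporalGraph n T = Fin T → Graph n

record TSColouring {n T} (𝒢 : TemporalGraph n T) : Set where
  field
    ψ      : Fin T → Fin n → Bool
    proper : ∀ t → Proper (𝒢 t) (ψ t)
open TSColouring public

differ : Bool → Bool → ℕ
differ true  true  = 0
differ false false = 0
differ true  false = 1
differ false true  = 1

-- Cost(Ψ) = #{ (v,t) : 1 ≤ t ≤ T-1, ψ_t(v) ≠ ψ_{t+1}(v) }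
costAux : ∀ {n T'} → (Fin (suc T') → Fin n → Bool) → ℕ
costAux {n} {T'} ψ =
  sum (map (λ t → sum (map (λ v → differ (ψ (inject₁ t) v) (ψ (fsuc t) v)) (allFin n)))
           (allFin T'))

Cost : ∀ {n T} {𝒢 : TemporalGraph n T} → TSColouring 𝒢 → ℕ
Cost {n} {zero}   Ψ = 0
Cost {n} {suc T'} Ψ = costAux (ψ Ψ)

-- The construction of S uses, for each t, a proper 2-colouring of each
-- component of G_t; such a family is the same thing as a proper
-- 2-colouring φ_t of G_t (restricted to each component).

AuxVertex : ℕ → ℕ → Set
AuxVertex n T = Fin n × Fin T

CEdge : ∀ {n T} → AuxVertex n T → AuxVertex n T → Set
CEdge (i , t) (j , t') = i ≡ j × toℕ t' ≡ suc (toℕ t)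

SEdge : ∀ {n T} → TemporalGraph n T → (Fin T → Fin n → Bool) →
        AuxVertex n T → AuxVertex n T → Set
SEdge 𝒢 φ (i , t) (j , t') = t ≡ t' × Reach (𝒢 t) i j × φ t i ≢ φ t j

αAdj : ∀ {n T} → TemporalGraph n T → (Fin T → Fin n → Bool) →
       AuxVertex n T → AuxVertex n T → Set
αAdj 𝒢 φ u w = CEdge u w ⊎ CEdge w u ⊎ SEdge 𝒢 φ u w

-- A fixed strict (lexicographic) order on AuxVertex, used to represent each
-- unordered edge {u , w} exactly once as the ordered pair with u ≺ w
_≺_ : ∀ {n T} → AuxVertex n T → AuxVertex n T → Set
(i , t) ≺ (j , t') = toℕ t < toℕ t' ⊎ (t ≡ t' × toℕ i < toℕ j)

-- An edge of α(𝒢) with both endpoints in the same class of the partition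
-- given by c : V(α(𝒢)) → {0,1}
MonoEdge : ∀ {n T} → TemporalGraph n T → (Fin T → Fin n → Bool) →
           (AuxVertex n T → Bool) → AuxVertex n T × AuxVertex n T → Set
MonoEdge 𝒢 φ c (u , w) = u ≺ w × αAdj 𝒢 φ u w × c u ≡ c w

NumberOf : {A : Set} → (A → Set) → ℕ → Set
NumberOf {A} P k =
  Σ (List A) λ xs → Unique xs × (∀ x → (x ∈ xs) ⇔ P x) × length xs ≡ k

{-# OPTIONS --safe #-}
module Submission where

-- Put v_{i,t} in class ψ_t(v_i) xor (t mod 2). A C-edge v_{i,t} v_{i,t+1} is then
-- monochromatic exactly when ψ_t(v_i) ≠ ψ_{t+1}(v_i), so these edges are counted by
-- Cost(Ψ). No S-edge is monochromatic: ψ_t xor φ_t is constant along walks of G_t, so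
-- vertices separated by φ_t within a component are separated by ψ_t as well.

open import Defs hiding (sym)
open import Data.Nat using (ℕ; zero; suc; _+_; _<_)
open import Data.Nat.Properties using (_≟_; <-irrefl; <-asym; n<1+n; suc-injective)
open import Data.Fin using (Fin; toℕ; inject₁) renaming (suc to fsuc; zero to fzero)
open import Data.Fin.Properties using (toℕ-inject₁; toℕ-injective) renaming (suc-injective to fsuc-injective)
open import Data.Bool using (Bool; true; false; not; _xor_)
open import Data.Bool.Properties using (not-injective; ¬-not; xor-annihilates-not)
open import Data.List using (List; []; _∷_; length; map; allFin; filter; cartesianProduct; _++_)
open import Data.List.Properties using (length-map; map-++; map-∘)
open import Data.Nat.ListAction using (sum)
open import Data.Nat.ListAction.Properties using (sum-++)
open import Data.List.Relation.Unary.Unique.Propositional using (Unique; [])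
open import Data.List.Relation.Unary.Unique.Propositional.Properties
  using (map⁺; filter⁺; cartesianProduct⁺; allFin⁺)
open import Data.List.Membership.Propositional using (_∈_)
open import Data.List.Membership.Propositional.Properties
  using (∈-map∘filter⁻; ∈-map∘filter⁺; ∈-cartesianProduct⁺; ∈-allFin)
open import Data.Product using (∃; _×_; _,_; proj₁; proj₂)
open import Data.Sum using (_⊎_; inj₁; inj₂)
open import Data.Empty using (⊥-elim)
open import Function.Base using (_∘_)
open import Function.Bundles using (_⇔_; mk⇔; Equivalence)
open import Function.Definitions using (Injective)
open import Function.Properties.Equivalence using () renaming (trans to ⇔-trans)
open import Relation.Nullary using (¬_)
open import Relation.Unary using (Decidable)
open import Relation.Binary.PropositionalEquality
  using (_≡_; _≢_; refl; sym; trans; cong; cong₂; subst; module ≡-Reasoning)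

length-filter-≟1 : {A : Set} (d : A → ℕ) → (∀ x → d x ≡ 0 ⊎ d x ≡ 1) → (xs : List A) →
                   length (filter (λ x → d x ≟ 1) xs) ≡ sum (map d xs)
length-filter-≟1 d d∈01 []       = refl
length-filter-≟1 d d∈01 (x ∷ xs) with d x | d∈01 x
... | .0 | inj₁ refl = length-filter-≟1 d d∈01 xs
... | .1 | inj₂ refl = cong suc (length-filter-≟1 d d∈01 xs)

sum-cartesianProduct : {A B : Set} (d : A × B → ℕ) (xs : List A) (ys : List B) →
                       sum (map d (cartesianProduct xs ys)) ≡
                       sum (map (λ x → sum (map (λ y → d (x , y)) ys)) xs)
sum-cartesianProduct d []       ys = refl
sum-cartesianProduct d (x ∷ xs) ys = begin
  sum (map d (map (x ,_) ys ++ cartesianProduct xs ys))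
    ≡⟨ cong sum (map-++ d (map (x ,_) ys) (cartesianProduct xs ys)) ⟩
  sum (map d (map (x ,_) ys) ++ map d (cartesianProduct xs ys))
    ≡⟨ sum-++ (map d (map (x ,_) ys)) _ ⟩
  sum (map d (map (x ,_) ys)) + sum (map d (cartesianProduct xs ys))
    ≡⟨ cong₂ _+_ (cong sum (sym (map-∘ ys))) (sum-cartesianProduct d xs ys) ⟩
  sum (map (λ y → d (x , y)) ys) + sum (map (λ x → sum (map (λ y → d (x , y)) ys)) xs) ∎
  where open ≡-Reasoning

NumberOf-resp-⇔ : {A : Set} {P Q : A → Set} {k : ℕ} →
                  (∀ x → P x ⇔ Q x) → NumberOf P k → NumberOf Q k
NumberOf-resp-⇔ P⇔Q (xs , unique , xs⇔P , length≡k) =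
  xs , unique , (λ x → ⇔-trans (xs⇔P x) (P⇔Q x)) , length≡k

NumberOf-image-filter : {A B : Set} {P : A → Set} (g : A → B) → Injective _≡_ _≡_ g →
                        (P? : Decidable P) {ys : List A} → Unique ys → (∀ y → y ∈ ys) →
                        NumberOf (λ x → ∃ λ y → x ≡ g y × P y) (length (filter P? ys))
NumberOf-image-filter g g-injective P? {ys} unique complete =
  map g (filter P? ys) ,
  map⁺ g-injective (filter⁺ P? unique) ,
  (λ x → mk⇔ (λ x∈ → let (y , _ , x≡gy , Py) = ∈-map∘filter⁻ g P? {xs = ys} x∈
                      in y , x≡gy , Py)
             (λ (y , x≡gy , Py) → ∈-map∘filter⁺ g P? (y , complete y , x≡gy , Py))) ,
  length-map g (filter P? ys)

parity : ℕ → Bool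
parity zero    = false
parity (suc k) = not (parity k)

xor-cancelˡ : ∀ x {y z} → x xor y ≡ x xor z → y ≡ z
xor-cancelˡ false eq = eq
xor-cancelˡ true  eq = not-injective eq

differ-01 : ∀ a b → differ a b ≡ 0 ⊎ differ a b ≡ 1
differ-01 true  true  = inj₁ refl
differ-01 true  false = inj₂ refl
differ-01 false true  = inj₂ refl
differ-01 false false = inj₁ refl

differ≡1⇔xor-not : ∀ p a b → differ a b ≡ 1 ⇔ (p xor a ≡ not p xor b)
differ≡1⇔xor-not false true  false = mk⇔ (λ _ → refl) (λ _ → refl)
differ≡1⇔xor-not false false true  = mk⇔ (λ _ → refl) (λ _ → refl)
differ≡1⇔xor-not true  true  false = mk⇔ (λ _ → refl) (λ _ → refl)
differ≡1⇔xor-not true  false true  = mk⇔ (λ _ → refl) (λ _ → refl)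
differ≡1⇔xor-not false true  true  = mk⇔ (λ ()) (λ ())
differ≡1⇔xor-not false false false = mk⇔ (λ ()) (λ ())
differ≡1⇔xor-not true  true  true  = mk⇔ (λ ()) (λ ())
differ≡1⇔xor-not true  false false = mk⇔ (λ ()) (λ ())

module _ {n} {G : Graph n} {ψ φ : Fin n → Bool} (ψ-proper : Proper G ψ) (φ-proper : Proper G φ) where

  Reach⇒xor-≡ : ∀ {i j} → Reach G i j → ψ i xor φ i ≡ ψ j xor φ j
  Reach⇒xor-≡ here = refl
  Reach⇒xor-≡ {i} (step {j = k} i~k k↝j) = begin
    ψ i xor φ i             ≡⟨ cong₂ _xor_ (¬-not (ψ-proper i~k)) (¬-not (φ-proper i~k)) ⟩
    not (ψ k) xor not (φ k) ≡⟨ xor-annihilates-not (ψ k) (φ k) ⟩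
    ψ k xor φ k             ≡⟨ Reach⇒xor-≡ k↝j ⟩
    _                       ∎
    where open ≡-Reasoning

  Reach⇒separated : ∀ {i j} → Reach G i j → φ i ≢ φ j → ψ i ≢ ψ j
  Reach⇒separated {i} {j} i↝j φi≢φj ψi≡ψj =
    φi≢φj (xor-cancelˡ (ψ i) (trans (Reach⇒xor-≡ i↝j) (cong (_xor φ j) (sym ψi≡ψj))))

timeEdge : ∀ {n T'} → Fin T' × Fin n → AuxVertex n (suc T') × AuxVertex n (suc T')
timeEdge (t , i) = (i , inject₁ t) , (i , fsuc t)

timeEdge-injective : ∀ {n T'} → Injective _≡_ _≡_ (timeEdge {n} {T'})
timeEdge-injective eq =
  cong₂ _,_ (fsuc-injective (cong (proj₂ ∘ proj₂) eq)) (cong (proj₁ ∘ proj₁) eq)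

timeEdge-CEdge : ∀ {n T'} (t : Fin T') (i : Fin n) → CEdge (i , inject₁ t) (i , fsuc t)
timeEdge-CEdge t i = refl , cong suc (sym (toℕ-inject₁ t))

CEdge⇒timeEdge : ∀ {n T'} {u w : AuxVertex n (suc T')} → CEdge u w → ∃ λ y → (u , w) ≡ timeEdge y
CEdge⇒timeEdge {w = _ , fzero}   (refl , ())
CEdge⇒timeEdge {u = i , t₀} {w = _ , fsuc t} (refl , eq) =
  (t , i) , cong (λ s → (i , s) , (i , fsuc t))
                 (toℕ-injective (trans (sym (suc-injective eq)) (sym (toℕ-inject₁ t))))

CEdge⇒≺ : ∀ {n T} {u w : AuxVertex n T} → CEdge u w → u ≺ w
CEdge⇒≺ {u = _ , t} (refl , eq) = inj₁ (subst (toℕ t <_) (sym eq) (n<1+n (toℕ t)))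

CEdge⇒⊀ : ∀ {n T} {u w : AuxVertex n T} → CEdge w u → ¬ (u ≺ w)
CEdge⇒⊀ {w = _ , t'} (_ , eq) (inj₁ t<t') =
  <-asym t<t' (subst (toℕ t' <_) (sym eq) (n<1+n (toℕ t')))
CEdge⇒⊀ {w = _ , t'} (_ , eq) (inj₂ (refl , _)) = <-irrefl eq (n<1+n (toℕ t'))

alternate : ∀ {n T} → (Fin T → Fin n → Bool) → AuxVertex n T → Bool
alternate ψ (i , t) = parity (toℕ t) xor ψ t i

flips : ∀ {n T'} → (Fin (suc T') → Fin n → Bool) → Fin T' × Fin n → ℕ
flips ψ (t , i) = differ (ψ (inject₁ t) i) (ψ (fsuc t) i)

length-filter-flips : ∀ {n T'} (ψ : Fin (suc T') → Fin n → Bool) →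
  length (filter (λ y → flips ψ y ≟ 1) (cartesianProduct (allFin T') (allFin n))) ≡ costAux ψ
length-filter-flips {n} {T'} ψ =
  trans (length-filter-≟1 (flips ψ) (λ (t , i) → differ-01 _ _)
                              (cartesianProduct (allFin T') (allFin n)))
        (sum-cartesianProduct (flips ψ) (allFin T') (allFin n))

flip⇔timeEdge-monochromatic : ∀ {n T'} (ψ : Fin (suc T') → Fin n → Bool) t i →
  flips ψ (t , i) ≡ 1 ⇔ (alternate ψ (i , inject₁ t) ≡ alternate ψ (i , fsuc t))
flip⇔timeEdge-monochromatic ψ t i rewrite toℕ-inject₁ t =
  differ≡1⇔xor-not (parity (toℕ t)) (ψ (inject₁ t) i) (ψ (fsuc t) i)

module _ {n T} {𝒢 : TemporalGraph n T} {ψ φ : Fin T → Fin n → Bool}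
         (ψ-proper : ∀ t → Proper (𝒢 t) (ψ t)) (φ-proper : ∀ t → Proper (𝒢 t) (φ t)) where

  SEdge⇒bichromatic : ∀ {u w} → SEdge 𝒢 φ u w → alternate ψ u ≢ alternate ψ w
  SEdge⇒bichromatic {_ , t} (refl , i↝j , φi≢φj) =
    Reach⇒separated (ψ-proper t) (φ-proper t) i↝j φi≢φj ∘ xor-cancelˡ (parity (toℕ t))

module _ {n T'} {𝒢 : TemporalGraph n (suc T')} {ψ φ : Fin (suc T') → Fin n → Bool}
         (ψ-proper : ∀ t → Proper (𝒢 t) (ψ t)) (φ-proper : ∀ t → Proper (𝒢 t) (φ t)) where

  MonoEdge⇒flip : ∀ x → MonoEdge 𝒢 φ (alternate ψ) x → ∃ λ y → x ≡ timeEdge y × flips ψ y ≡ 1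
  MonoEdge⇒flip _ (_ , inj₁ c , monochromatic) with CEdge⇒timeEdge c
  ... | (t , i) , refl =
    (t , i) , refl , Equivalence.from (flip⇔timeEdge-monochromatic ψ t i) monochromatic
  MonoEdge⇒flip _ (u≺w , inj₂ (inj₁ c) , _) = ⊥-elim (CEdge⇒⊀ c u≺w)
  MonoEdge⇒flip _ (_ , inj₂ (inj₂ s) , monochromatic) =
    ⊥-elim (SEdge⇒bichromatic {𝒢 = 𝒢} ψ-proper φ-proper s monochromatic)

  flip⇔MonoEdge : ∀ x → (∃ λ y → x ≡ timeEdge y × flips ψ y ≡ 1) ⇔ MonoEdge 𝒢 φ (alternate ψ) x
  flip⇔MonoEdge x = mk⇔ flip⇒MonoEdge (MonoEdge⇒flip x)
    where
    flip⇒MonoEdge : (∃ λ y → x ≡ timeEdge y × flips ψ y ≡ 1) → MonoEdge 𝒢 φ (alternate ψ) x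
    flip⇒MonoEdge ((t , i) , refl , flip) =
      CEdge⇒≺ (timeEdge-CEdge t i) , inj₁ (timeEdge-CEdge t i) ,
      Equivalence.to (flip⇔timeEdge-monochromatic ψ t i) flip

lemma2 : ∀ {n T} (𝒢 : TemporalGraph n T) (Ψ : TSColouring 𝒢)
           (φ : Fin T → Fin n → Bool) → (∀ t → Proper (𝒢 t) (φ t)) →
           ∃ λ (c : AuxVertex n T → Bool) → NumberOf (MonoEdge 𝒢 φ c) (Cost Ψ)
lemma2 {T = zero} 𝒢 Ψ φ φ-proper = alternate (ψ Ψ) , [] , [] , (λ { ((_ , ()) , _) }) , refl
lemma2 {n} {suc T'} 𝒢 Ψ φ φ-proper =
  alternate (ψ Ψ) ,
  subst (NumberOf _) (length-filter-flips (ψ Ψ))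
    (NumberOf-resp-⇔ (flip⇔MonoEdge (proper Ψ) φ-proper)
      (NumberOf-image-filter timeEdge timeEdge-injective (λ y → flips (ψ Ψ) y ≟ 1)
        (cartesianProduct⁺ (allFin⁺ T') (allFin⁺ n))
        (λ (t , i) → ∈-cartesianProduct⁺ (∈-allFin t) (∈-allFin i))))
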